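{- Let $\alpha$ be a composition, $w=\mathfrak{t}_{i_1}\cdots\mathfrak{t}_{i_n}\in CRHW_n$ with $w(\alpha)=\beta\ne0$, and $\tau$ the filling of $\beta/\!\!/\alpha$ corresponding to $w$. Let $j\ge1$ belong to $\mathrm{supp}(w)$ but not be its greatest element. If $j\in\mathrm{leg}(w)$, then (i) the greatest entry of $\tau$ in column $j$ is strictly greater than the greatest entry of $\tau$ in column $j+1$, and (ii) all other entries of $\tau$ in column $j$ are strictly smaller than the smallest entry of $\tau$ in column $j+1$.
   Context: A composition is a finite sequence of positive integers; its diagram has $\alpha_i$ left-justified boxes in row $i$, rows numbered top to bottom. Box-adding operators: $\mathfrak{t}_1(\alpha)=(1,\alpha_1,\ldots,\alpha_k)$ (a new top row of one box, previous rows moving down one); for $i\ge2$, $\mathfrak{t}_i(\alpha)$ adds one box at the end of the topmost row of length $i-1$ (in column $i$) if one exists, else is $0$; $\mathfrak{t}_i(0)=0$. A word $w=\mathfrak{t}_{i_1}\cdots\mathfrak{t}_{i_n}$ acts by applying $\mathfrak{t}_{i_n}$ first. For $0\le k\le n-1$, $w$ is a reverse $k$-hookword if $i_1\le\cdots\le i_{k+1}>i_{k+2}>\cdots>i_n$; then $\mathrm{leg}(w)=\{i_{k+1},\ldots,i_n\}$ and $\mathrm{supp}(w)=\{i_1,\ldots,i_n\}$; $w$ is connected if $\mathrm{supp}(w)$ is a set of consecutive integers; $CRHW_n$ is the set of connected reverse hookwords of length $n$. If $w(\alpha)=\beta\ne0$, the boxes added during the successive applications form the skew shape $\beta/\!\!/\alpha$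 (the diagram of $\beta$ minus the diagram of $\alpha$ placed in the bottom $l(\alpha)$ rows); the filling $\tau$ corresponding to $w$ places $n-m+1$ in the $m$-th box added. Columns of $\tau$ refer to the boxes of $\beta/\!\!/\alpha$ in a given column. -}

module Defs where

open import Data.Nat using (ℕ; zero; suc; _+_; _∸_; _≤_; _<_; _>_; _⊔_; _≟_)
open import Data.List using (List; []; _∷_; map; length; take; drop; filter; zipWith; upTo; _++_; [_]; foldr)
open import Data.List.Relation.Unary.All using (All)
open import Data.List.Relation.Unary.Linked using (Linked)
open import Data.List.Membership.Propositional using (_∈_)
open import Data.Maybe using (Maybe; just; nothing; _>>=_)
open import Data.Product using (_×_; _,_; proj₁; proj₂)
open import Relation.Binary.PropositionalEquality using (_≡_)
open import Relation.Nullary using (yes; no)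

-- A composition: a list of positive integers (row lengths, top to bottom).
IsComposition : List ℕ → Set
IsComposition α = All (λ x → 1 ≤ x) α

-- A box of the diagram: (row, column), rows 0-indexed from the top,
-- columns 1-indexed from the left.
Box : Set
Box = ℕ × ℕ

addToTopmost : ℕ → List ℕ → Maybe (List ℕ × ℕ)
addToTopmost m [] = nothing
addToTopmost m (a ∷ α) with a ≟ m
... | yes _ = just (suc a ∷ α , 0)
... | no _ with addToTopmost m α
...   | nothing = nothing
...   | just (α' , r) = just (a ∷ α' , suc r)

shiftDown : List Box → List Box
shiftDown = map (λ b → suc (proj₁ b) , proj₂ b)

-- One operator t_i acting on (current composition, boxes added so far in
-- order of addition, in current row coordinates).  t_0 is undefined (0).
step : ℕ → List ℕ × List Box → Maybe (List ℕ × List Box)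
step zero _ = nothing
step (suc zero) (α , bs) = just (1 ∷ α , shiftDown bs ++ [ (0 , 1) ])
step (suc (suc m)) (α , bs) with addToTopmost (suc m) α
... | nothing = nothing
... | just (α' , r) = just (α' , bs ++ [ (r , suc (suc m)) ])

-- w = t_{i_1} ⋯ t_{i_n} is represented by the list (i_1 ∷ … ∷ i_n);
-- t_{i_n} acts first.
run : List ℕ → List ℕ → Maybe (List ℕ × List Box)
run [] α = just (α , [])
run (i ∷ is) α = run is α >>= step i

-- w(α), with nothing meaning 0.
act : List ℕ → List ℕ → Maybe (List ℕ)
act w α = run w α >>= λ p → just (proj₁ p)

addedBoxes : List ℕ → List ℕ → Maybe (List Box)
addedBoxes w α = run w α >>= λ p → just (proj₂ p)

-- A filled box: (row, column, entry).
FilledBox : Set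
FilledBox = ℕ × ℕ × ℕ

-- The m-th added box (m = 1,…,n) receives the entry n - m + 1.
label : ℕ → List Box → List FilledBox
label n bs = zipWith (λ m b → proj₁ b , proj₂ b , n ∸ m) (upTo (length bs)) bs

filling : List ℕ → List ℕ → Maybe (List FilledBox)
filling w α = addedBoxes w α >>= λ bs → just (label (length w) bs)

columnEntries : ℕ → List FilledBox → List ℕ
columnEntries j τ =
  map (λ b → proj₂ (proj₂ b)) (filter (λ b → proj₁ (proj₂ b) ≟ j) τ)

maxL : List ℕ → ℕ
maxL = foldr _⊔_ 0

-- w = t_{i_1}⋯t_{i_n} is a reverse k-hookword:
-- i_1 ≤ ⋯ ≤ i_{k+1} > i_{k+2} > ⋯ > i_n, with 0 ≤ k ≤ n-1.
IsReverseHookword : ℕ → List ℕ → Set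
IsReverseHookword k w =
  (suc k ≤ length w) × Linked _≤_ (take (suc k) w) × Linked _>_ (drop k w)

leg : ℕ → List ℕ → List ℕ
leg k w = drop k w

IsConnected : List ℕ → Set
IsConnected w = ∀ a b c → a ∈ w → c ∈ w → a ≤ b → b ≤ c → b ∈ w

IsWord : List ℕ → Set
IsWord w = All (λ i → 1 ≤ i) w

-- In the filling τ the box added by the operator at position p of w (counting from 0)
-- receives the entry p + 1, so the entries of column c are exactly the numbers p + 1
-- with w at position p equal to c.  Since j lies in the strictly decreasing leg, it
-- occurs there at a single position q, and every other occurrence of j lies in the
-- weakly increasing arm.  Every occurrence of j + 1 comes before q, and after each arm
-- occurrence of j.  Hence column j has maximum q + 1, which exceeds all entries of
-- column j + 1, while its other entries lie below all of them.
module Submission where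

open import Defs
open import Data.Nat using (ℕ; zero; suc; _+_; _∸_; _≤_; _<_; _>_; _≟_; _<?_; z≤n; s≤s)
open import Data.Nat.Properties
open import Data.List using (List; []; _∷_; map; length; take; drop; zipWith; applyUpTo; _++_; [_]; reverse)
open import Data.List.Properties using (map-++; unfold-reverse; reverse-involutive; length-reverse)
open import Data.List.Membership.Propositional using (_∈_)
open import Data.List.Membership.Propositional.Properties using (∈-map⁺; ∈-map⁻; ∈-filter⁺; ∈-filter⁻)
open import Data.List.Relation.Unary.Any as Any using ()
open import Data.List.Relation.Unary.Linked using (Linked; []; [-]; _∷_)
open import Data.Maybe using (just)
open import Data.Product using (Σ; ∃-syntax; _×_; _,_; proj₁; proj₂)
open import Data.Sum using (_⊎_; inj₁; inj₂; [_,_]′)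
open import Data.Empty using (⊥-elim)
open import Relation.Binary.PropositionalEquality using (_≡_; _≢_; refl; sym; trans; cong; subst; module ≡-Reasoning)
open import Relation.Binary.Definitions using (Transitive; tri<; tri≈; tri>)
open import Relation.Nullary using (yes; no)
open import Function using (_∘_; id)

private
  variable
    A : Set
    a b x : A
    xs ys : List A
    k p p' s t : ℕ

infix 4 _[_]=_

data _[_]=_ {A : Set} : List A → ℕ → A → Set where
  here  : (x ∷ xs) [ 0 ]= x
  there : xs [ p ]= a → (x ∷ xs) [ suc p ]= a

[]=-functional : xs [ p ]= a → xs [ p ]= b → a ≡ b
[]=-functional here      here      = refl
[]=-functional (there u) (there v) = []=-functional u v

[]=⇒<length : xs [ p ]= a → p < length xs
[]=⇒<length here      = s≤s z≤n
[]=⇒<length (there u) = s≤s ([]=⇒<length u)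

∈⇒[]= : x ∈ xs → ∃[ p ] xs [ p ]= x
∈⇒[]= (Any.here refl) = 0 , here
∈⇒[]= (Any.there x∈xs) with ∈⇒[]= x∈xs
... | p , u = suc p , there u

[]=-++⁺ˡ : ∀ ys → xs [ p ]= a → (xs ++ ys) [ p ]= a
[]=-++⁺ˡ ys here      = here
[]=-++⁺ˡ ys (there u) = there ([]=-++⁺ˡ ys u)

[]=-∷ʳ : ∀ (xs : List A) x → (xs ++ [ x ]) [ length xs ]= x
[]=-∷ʳ []       x = here
[]=-∷ʳ (y ∷ xs) x = there ([]=-∷ʳ xs x)

[]=-reverse⁺ : xs [ p ]= a → reverse xs [ length xs ∸ suc p ]= a
[]=-reverse⁺ {xs = x ∷ xs} here rewrite unfold-reverse x xs =
  subst (λ l → (reverse xs ++ [ x ]) [ l ]= x) (length-reverse xs) ([]=-∷ʳ (reverse xs) x)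
[]=-reverse⁺ {xs = x ∷ xs} (there u) rewrite unfold-reverse x xs = []=-++⁺ˡ [ x ] ([]=-reverse⁺ u)

[]=-reverse⁻ : reverse xs [ p ]= a → xs [ length xs ∸ suc p ]= a
[]=-reverse⁻ {xs = xs} u with []=-reverse⁺ u
... | v rewrite reverse-involutive xs | length-reverse xs = v

[]=-drop⁺ : ∀ k (xs : List A) → xs [ k + t ]= a → drop k xs [ t ]= a
[]=-drop⁺ zero    xs       u         = u
[]=-drop⁺ (suc k) (x ∷ xs) (there u) = []=-drop⁺ k xs u

[]=-drop⁻ : ∀ k (xs : List A) → drop k xs [ t ]= a → xs [ k + t ]= a
[]=-drop⁻ zero    xs       u = u
[]=-drop⁻ (suc k) (x ∷ xs) u = there ([]=-drop⁻ k xs u)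

[]=-take⁺ : ∀ k → xs [ p ]= a → p < k → take k xs [ p ]= a
[]=-take⁺ (suc k) here      _         = here
[]=-take⁺ (suc k) (there u) (s≤s p<k) = there ([]=-take⁺ k u p<k)

module _ {R : A → A → Set} (R-trans : Transitive R) where

  Linked-[]= : Linked R xs → xs [ p ]= a → xs [ p' ]= b → p < p' → R a b
  Linked-[]= l         (there u) (there v) (s≤s p<p') = Linked-[]= (tail l) u v p<p'
    where
    tail : ∀ {y ys} → Linked R (y ∷ ys) → Linked R ys
    tail [-]     = []
    tail (_ ∷ l) = l
  Linked-[]= (Rxy ∷ l) here      (there v) _          = head Rxy l v
    where
    head : ∀ {x y ys p b} → R x y → Linked R (y ∷ ys) → (y ∷ ys) [ p ]= b → R x b
    head Rxy _          here      = Rxy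
    head Rxy (Ryz ∷ l) (there v) = head (R-trans Rxy Ryz) l v

maxL-≤ : ∀ {n} xs → (∀ x → x ∈ xs → x ≤ n) → maxL xs ≤ n
maxL-≤ []       _   = z≤n
maxL-≤ (x ∷ xs) xs≤ =
  ⊔-lub (xs≤ x (Any.here refl)) (maxL-≤ xs (λ y y∈xs → xs≤ y (Any.there y∈xs)))

≤-maxL : ∀ {n ns} → n ∈ ns → n ≤ maxL ns
≤-maxL {ns = m ∷ ns} (Any.here refl)  = m≤m⊔n m (maxL ns)
≤-maxL {ns = m ∷ ns} (Any.there n∈ns) = ≤-trans (≤-maxL n∈ns) (m≤n⊔m m (maxL ns))

maxL-≡ : ∀ {n ns} → n ∈ ns → (∀ x → x ∈ ns → x ≤ n) → maxL ns ≡ n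
maxL-≡ n∈ns ns≤n = ≤-antisym (maxL-≤ _ ns≤n) (≤-maxL n∈ns)

module _ {w : List ℕ} (hw : IsReverseHookword k w) where

  private
    arm : Linked _≤_ (take (suc k) w)
    arm = proj₁ (proj₂ hw)
    leg-decreasing : Linked _>_ (drop k w)
    leg-decreasing = proj₂ (proj₂ hw)

  hook-arm-≤ : p < p' → p' ≤ k → w [ p ]= a → w [ p' ]= b → a ≤ b
  hook-arm-≤ p<p' p'≤k u v =
    Linked-[]= ≤-trans arm ([]=-take⁺ (suc k) u (<-≤-trans p<p' (m≤n⇒m≤1+n p'≤k)))
                           ([]=-take⁺ (suc k) v (s≤s p'≤k)) p<p'

  hook-leg-> : k ≤ p → p < p' → w [ p ]= a → w [ p' ]= b → b < a
  hook-leg-> {p = p} {p' = p'} k≤p p<p' u v =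
    Linked-[]= (λ b<a c<b → <-trans c<b b<a) leg-decreasing (drop⁺ k≤p u) (drop⁺ k≤p' v)
      (∸-monoˡ-< p<p' k≤p)
    where
    k≤p' : k ≤ p'
    k≤p' = ≤-trans k≤p (<⇒≤ p<p')
    drop⁺ : ∀ {p a} → k ≤ p → w [ p ]= a → drop k w [ p ∸ k ]= a
    drop⁺ {p} k≤p u = []=-drop⁺ k w (subst (λ i → w [ i ]= _) (sym (m+[n∸m]≡n k≤p)) u)

  hook-leg-unique : k ≤ p → k ≤ s → w [ p ]= a → w [ s ]= a → p ≡ s
  hook-leg-unique {p = p} {s = s} k≤p k≤s u v with <-cmp p s
  ... | tri< p<s _ _ = ⊥-elim (<-irrefl refl (hook-leg-> k≤p p<s u v))
  ... | tri≈ _ p≡s _ = p≡s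
  ... | tri> _ _ s<p = ⊥-elim (<-irrefl refl (hook-leg-> k≤s s<p v u))

  leg-or-arm : k ≤ s → w [ s ]= a → w [ p ]= a → p ≡ s ⊎ p < k
  leg-or-arm {p = p} k≤s v u with p <? k
  ... | yes p<k = inj₂ p<k
  ... | no p≮k  = inj₁ (hook-leg-unique (≮⇒≥ p≮k) k≤s u v)

  larger-before-leg : k ≤ s → w [ s ]= a → w [ p ]= b → a < b → p < s
  larger-before-leg {s = s} {p = p} k≤s v u a<b with <-cmp p s
  ... | tri< p<s _ _ = p<s
  ... | tri≈ _ refl _ = ⊥-elim (<-irrefl ([]=-functional v u) a<b)
  ... | tri> _ _ s<p = ⊥-elim (<-asym a<b (hook-leg-> k≤s s<p v u))

  arm-before-larger : p ≤ k → w [ p ]= a → w [ p' ]= b → a < b → p < p'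
  arm-before-larger {p = p} {p' = p'} p≤k u v a<b with <-cmp p p'
  ... | tri< p<p' _ _ = p<p'
  ... | tri≈ _ refl _ = ⊥-elim (<-irrefl ([]=-functional u v) a<b)
  ... | tri> _ _ p'<p = ⊥-elim (<⇒≱ a<b (hook-arm-≤ p'<p p≤k v u))

column entry : FilledBox → ℕ
column = proj₁ ∘ proj₂
entry  = proj₂ ∘ proj₂

∈-columnEntries⁻ : ∀ {c n} τ → n ∈ columnEntries c τ →
                   ∃[ y ] y ∈ τ × column y ≡ c × entry y ≡ n
∈-columnEntries⁻ {c} τ n∈col with ∈-map⁻ entry n∈col
... | y , y∈col , refl with ∈-filter⁻ (λ b → column b ≟ c) {xs = τ} y∈col
...   | y∈τ , refl = y , y∈τ , refl , refl

∈-columnEntries⁺ : ∀ {c y τ} → y ∈ τ → column y ≡ c → entry y ∈ columnEntries c τ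
∈-columnEntries⁺ {c} y∈τ refl = ∈-map⁺ entry (∈-filter⁺ (λ b → column b ≟ c) y∈τ refl)

step-columns : ∀ i {α bs α' bs'} → step i (α , bs) ≡ just (α' , bs') →
               map proj₂ bs' ≡ map proj₂ bs ++ [ i ]
step-columns (suc zero) {bs = bs} refl =
  trans (map-++ proj₂ (shiftDown bs) [ (0 , 1) ]) (cong (_++ [ 1 ]) (shiftDown-columns bs))
  where
  shiftDown-columns : ∀ bs → map proj₂ (shiftDown bs) ≡ map proj₂ bs
  shiftDown-columns []       = refl
  shiftDown-columns (b ∷ bs) = cong (proj₂ b ∷_) (shiftDown-columns bs)
step-columns (suc (suc m)) {α} eq with addToTopmost (suc m) α
step-columns (suc (suc m)) {bs = bs} refl | just (_ , r) = map-++ proj₂ bs [ (r , suc (suc m)) ]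

run-columns : ∀ w {α α' bs} → run w α ≡ just (α' , bs) → map proj₂ bs ≡ reverse w
run-columns []       refl = refl
run-columns (i ∷ is) {α} eq with run is α in run-is
... | just (_ , bs₀) = begin
  _                          ≡⟨ step-columns i eq ⟩
  map proj₂ bs₀ ++ [ i ]     ≡⟨ cong (_++ [ i ]) (run-columns is run-is) ⟩
  reverse is ++ [ i ]        ≡⟨ unfold-reverse i is ⟨
  reverse (i ∷ is)           ∎
  where open ≡-Reasoning

-- label n bs is labelFrom id n bs; the offset f lets the induction pass to the tail.
labelFrom : (ℕ → ℕ) → ℕ → List Box → List FilledBox
labelFrom f n bs = zipWith (λ m b → proj₁ b , proj₂ b , n ∸ m) (applyUpTo f (length bs)) bs

∈-labelFrom⁻ : ∀ f n bs {y} → y ∈ labelFrom f n bs →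
               ∃[ m ] map proj₂ bs [ m ]= column y × entry y ≡ n ∸ f m
∈-labelFrom⁻ f n (b ∷ bs) (Any.here refl) = 0 , here , refl
∈-labelFrom⁻ f n (b ∷ bs) (Any.there y∈ys) with ∈-labelFrom⁻ (f ∘ suc) n bs y∈ys
... | m , u , e = suc m , there u , e

∈-labelFrom⁺ : ∀ f n bs {m c} → map proj₂ bs [ m ]= c →
               ∃[ y ] y ∈ labelFrom f n bs × column y ≡ c × entry y ≡ n ∸ f m
∈-labelFrom⁺ f n (b ∷ bs) here      = _ , Any.here refl , refl , refl
∈-labelFrom⁺ f n (b ∷ bs) (there u) with ∈-labelFrom⁺ (f ∘ suc) n bs u
... | y , y∈ys , e₁ , e₂ = y , Any.there y∈ys , e₁ , e₂

filling⇒run : ∀ {w α τ} → filling w α ≡ just τ →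
              ∃[ β ] ∃[ bs ] run w α ≡ just (β , bs) × label (length w) bs ≡ τ
filling⇒run {w} {α} fill with run w α
filling⇒run refl | just (β , bs) = β , bs , refl , refl

module _ {w α β bs} (run-w : run w α ≡ just (β , bs)) where

  private
    n : ℕ
    n = length w
    bs-columns : map proj₂ bs ≡ reverse w
    bs-columns = run-columns w run-w
    index-in-reverse : ∀ {m c} → map proj₂ bs [ m ]= c → reverse w [ m ]= c
    index-in-reverse {m} {c} = subst (λ l → l [ m ]= c) bs-columns
    index-in-boxes : ∀ {m c} → reverse w [ m ]= c → map proj₂ bs [ m ]= c
    index-in-boxes {m} {c} = subst (λ l → l [ m ]= c) (sym bs-columns)

  label-column⁻ : ∀ {c x} → x ∈ columnEntries c (label n bs) → ∃[ p ] w [ p ]= c × x ≡ suc p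
  label-column⁻ x∈col with ∈-columnEntries⁻ (label n bs) x∈col
  ... | y , y∈τ , refl , refl with ∈-labelFrom⁻ id n bs y∈τ
  ...   | m , u , x≡n∸m = n ∸ suc m , []=-reverse⁻ (index-in-reverse u) ,
                          trans x≡n∸m (+-∸-assoc 1 m<n)
    where
    m<n : m < n
    m<n = subst (m <_) (length-reverse w) ([]=⇒<length (index-in-reverse u))

  label-column⁺ : ∀ {c p} → w [ p ]= c → suc p ∈ columnEntries c (label n bs)
  label-column⁺ u with ∈-labelFrom⁺ id n bs (index-in-boxes ([]=-reverse⁺ u))
  ... | y , y∈τ , col , ent =
    subst (_∈ columnEntries _ (label n bs)) (trans ent (m∸[m∸n]≡n ([]=⇒<length u)))
          (∈-columnEntries⁺ y∈τ col)

filling-column⁻ : ∀ w α {τ c x} → filling w α ≡ just τ → x ∈ columnEntries c τ →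
                  ∃[ p ] w [ p ]= c × x ≡ suc p
filling-column⁻ w α fill with filling⇒run {w} {α} fill
... | _ , _ , run-w , refl = label-column⁻ run-w

filling-column⁺ : ∀ w α {τ c p} → filling w α ≡ just τ → w [ p ]= c →
                  suc p ∈ columnEntries c τ
filling-column⁺ w α fill with filling⇒run {w} {α} fill
... | _ , _ , run-w , refl = label-column⁺ run-w

filling-column-≤ : ∀ w α {τ c m} → filling w α ≡ just τ → (∀ {p} → w [ p ]= c → p < m) →
                   ∀ x → x ∈ columnEntries c τ → x ≤ m
filling-column-≤ w α fill c-before-m x x∈col with filling-column⁻ w α fill x∈col
... | p , u , refl = c-before-m u

lemma5p7 : (α β : List ℕ) (w : List ℕ) (k : ℕ) (τ : List FilledBox) (j : ℕ) →
    IsComposition α → IsWord w → IsReverseHookword k w → IsConnected w →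
    act w α ≡ just β → filling w α ≡ just τ →
    1 ≤ j → j ∈ w → Σ ℕ (λ m → m ∈ w × j < m) →
    j ∈ leg k w →
    (maxL (columnEntries (suc j) τ) < maxL (columnEntries j τ))
    × (∀ x → x ∈ columnEntries j τ → x ≢ maxL (columnEntries j τ) →
    ∀ y → y ∈ columnEntries (suc j) τ → x < y)
lemma5p7 α β w k τ j _ _ hw _ _ fill _ _ _ j∈leg = max[j+1]<max[j] , others[j]<[j+1]
  where
  q : ℕ
  q = k + proj₁ (∈⇒[]= j∈leg)

  k≤q : k ≤ q
  k≤q = m≤m+n k _

  w[q]=j : w [ q ]= j
  w[q]=j = []=-drop⁻ k w (proj₂ (∈⇒[]= j∈leg))

  j-at-q-or-arm : ∀ {p} → w [ p ]= j → p ≡ q ⊎ p < k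
  j-at-q-or-arm = leg-or-arm hw k≤q w[q]=j

  max[j]≡1+q : maxL (columnEntries j τ) ≡ suc q
  max[j]≡1+q = maxL-≡ (filling-column⁺ w α fill w[q]=j) (filling-column-≤ w α fill j-not-after-q)
    where
    j-not-after-q : ∀ {p} → w [ p ]= j → p < suc q
    j-not-after-q u =
      [ (λ { refl → ≤-refl }) , (λ p<k → m≤n⇒m≤1+n (<-≤-trans p<k k≤q)) ]′ (j-at-q-or-arm u)

  max[j+1]<max[j] : maxL (columnEntries (suc j) τ) < maxL (columnEntries j τ)
  max[j+1]<max[j] rewrite max[j]≡1+q =
    s≤s (maxL-≤ _ (filling-column-≤ w α fill (λ u → larger-before-leg hw k≤q w[q]=j u (n<1+n j))))

  others[j]<[j+1] : ∀ x → x ∈ columnEntries j τ → x ≢ maxL (columnEntries j τ) →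
                    ∀ y → y ∈ columnEntries (suc j) τ → x < y
  others[j]<[j+1] x x∈col x≢max y y∈col
    with filling-column⁻ w α fill x∈col | filling-column⁻ w α fill y∈col
  ... | p , u , refl | p' , v , refl with j-at-q-or-arm u
  ...   | inj₁ refl = ⊥-elim (x≢max (sym max[j]≡1+q))
  ...   | inj₂ p<k  = s≤s (arm-before-larger hw (<⇒≤ p<k) u v (n<1+n j))
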